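{- Let $E$ be a set of linear and regular equations over a signature $\Sigma$ and $X$ a set of variables. For every continuous model $M$ of $E$ and every valuation $\sigma:X\to M$, the map $\sigma^\flat:\mathcal L(X)_E\to M$, $\sigma^\flat(L)=\bigvee_{a\in L}\hat\sigma(a)$, is a continuous (arbitrary-join preserving) homomorphism of $\Sigma$-algebras.
   Context: Linear and regular equations: each variable occurs at most once on each side and the same variables occur on both sides. Atoms: terms over $\Sigma$ and $X$ modulo the congruence generated by $E$ (the free model of $E$ over $X$); for a model $M$ of $E$, $\hat\sigma$ is the unique homomorphism from atoms to $M$ extending $\sigma$. $\mathcal L(X)_E$ is the set of sets of atoms, ordered by inclusion, with operations $s(L_1,\dots,L_n)=\{s(a_1,\dots,a_n)\mid a_i\in L_i\}$. A continuous model of $E$ is a $\Sigma$-algebra on a complete lattice, with monotone operations, satisfying $E$, whose operations preserve arbitrary joins in each argument. -}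

module Defs where

open import Data.Nat using (ℕ; zero; suc; _+_)
import Data.Nat as ℕ
open import Data.Fin using (Fin; zero; suc)
import Data.Fin as F
open import Data.Product using (Σ; Σ-syntax; ∃; _×_; _,_; proj₁; proj₂)
open import Relation.Nullary using (yes; no)
open import Relation.Binary.Bundles using (Poset)
open import Level using (0ℓ)

record Signature : Set₁ where
  field
    Op    : Set
    arity : Op → ℕ

module _ (Sig : Signature) where
  open Signature Sig

  data Term (X : Set) : Set where
    var : X → Term X
    op  : (o : Op) → (Fin (arity o) → Term X) → Term X

  subst : {X Y : Set} → (Y → Term X) → Term Y → Term X
  subst θ (var y)   = θ y
  subst θ (op o ts) = op o (λ i → subst θ (ts i))

  record Equation : Set where
    constructor _≐_
    field
      lhs rhs : Term ℕ

  sumFin : (n : ℕ) → (Fin n → ℕ) → ℕ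
  sumFin zero    f = 0
  sumFin (suc n) f = f zero + sumFin n (λ i → f (suc i))

  occ : ℕ → Term ℕ → ℕ
  occ x (var y) with x ℕ.≟ y
  ... | yes _ = 1
  ... | no  _ = 0
  occ x (op o ts) = sumFin (arity o) (λ i → occ x (ts i))

  Linear : Equation → Set
  Linear (l ≐ r) = ∀ x → (occ x l ℕ.≤ 1) × (occ x r ℕ.≤ 1)

  Regular : Equation → Set
  Regular (l ≐ r) = ∀ x → (1 ℕ.≤ occ x l → 1 ℕ.≤ occ x r) × (1 ℕ.≤ occ x r → 1 ℕ.≤ occ x l)

  data _⊢_≈_ (E : Equation → Set) {X : Set} : Term X → Term X → Set where
    ≈-refl  : ∀ {a} → E ⊢ a ≈ a
    ≈-sym   : ∀ {a b} → E ⊢ a ≈ b → E ⊢ b ≈ a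
    ≈-trans : ∀ {a b c} → E ⊢ a ≈ b → E ⊢ b ≈ c → E ⊢ a ≈ c
    ≈-cong  : ∀ o {as bs} → (∀ i → E ⊢ as i ≈ bs i) → E ⊢ op o as ≈ op o bs
    ≈-ax    : ∀ {e} → E e → (θ : ℕ → Term X) →
              E ⊢ subst θ (Equation.lhs e) ≈ subst θ (Equation.rhs e)

  -- Sets of atoms: subsets of the free model (Term X modulo E), i.e.
  -- predicates on terms closed under the congruence.
  record AtomSet (E : Equation → Set) (X : Set) : Set₁ where
    field
      mem    : Term X → Set
      closed : ∀ {a b} → E ⊢ a ≈ b → mem a → mem b
  open AtomSet public

  opL : {E : Equation → Set} {X : Set} (o : Op) →
        (Fin (arity o) → AtomSet E X) → AtomSet E X
  opL {E} {X} o Ls = record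
    { mem    = λ a → Σ[ as ∈ (Fin (arity o) → Term X) ]
                       ((∀ i → mem (Ls i) (as i)) × E ⊢ op o as ≈ a)
    ; closed = λ { a≈b (as , m , p) → as , m , ≈-trans p a≈b } }

  -- Arbitrary joins in 𝓛(X)_E (ordered by inclusion) are unions.
  ⋃ : {E : Equation → Set} {X : Set} {I : Set} → (I → AtomSet E X) → AtomSet E X
  ⋃ {I = I} Ls = record
    { mem    = λ a → Σ[ i ∈ I ] mem (Ls i) a
    ; closed = λ { a≈b (i , m) → i , closed (Ls i) a≈b m } }

_[_≔_] : {A : Set} {n : ℕ} → (Fin n → A) → Fin n → A → (Fin n → A)
(xs [ i ≔ x ]) j with i F.≟ j
... | yes _ = x
... | no  _ = xs j

record ContinuousAlgebra (Sig : Signature) : Set₁ where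
  open Signature Sig
  field
    poset : Poset 0ℓ 0ℓ 0ℓ
  open Poset poset public renaming (Carrier to C)
  field
    ⋁        : {I : Set} → (I → C) → C
    ⋁-upper  : {I : Set} (f : I → C) (i : I) → f i ≤ ⋁ f
    ⋁-least  : {I : Set} (f : I → C) (b : C) → (∀ i → f i ≤ b) → ⋁ f ≤ b
    ⟦_⟧      : (o : Op) → (Fin (arity o) → C) → C
    monotone : (o : Op) (xs ys : Fin (arity o) → C) →
               (∀ i → xs i ≤ ys i) → ⟦ o ⟧ xs ≤ ⟦ o ⟧ ys
    continuous : (o : Op) (xs : Fin (arity o) → C) (i : Fin (arity o))
                 {I : Set} (f : I → C) →
                 ⟦ o ⟧ (xs [ i ≔ ⋁ f ]) ≈ ⋁ (λ j → ⟦ o ⟧ (xs [ i ≔ f j ]))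

module _ {Sig : Signature} (M : ContinuousAlgebra Sig) where
  open ContinuousAlgebra M

  eval : {X : Set} → (X → C) → Term Sig X → C
  eval σ (var x)   = σ x
  eval σ (op o ts) = ⟦ o ⟧ (λ i → eval σ (ts i))

  Satisfies : (Equation Sig → Set) → Set
  Satisfies E = ∀ e → E e → (ρ : ℕ → C) →
                eval ρ (Equation.lhs e) ≈ eval ρ (Equation.rhs e)

  flat : {E : Equation Sig → Set} {X : Set} → (X → C) → AtomSet Sig E X → C
  flat σ L = ⋁ {Σ (Term Sig _) (mem L)} (λ p → eval σ (proj₁ p))

-- Soundness: since M satisfies E, the term evaluation σ̂ is constant on E-classes, so σ♭ is
-- well defined on sets of atoms and σ♭(s(L₁,…,Lₙ)) ≤ s(σ♭ L₁,…,σ♭ Lₙ) by monotonicity.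
-- Conversely, an operation preserving joins in each argument separately preserves them
-- jointly (replace one argument at a time), so s(σ♭ L₁,…,σ♭ Lₙ) is the join of the values
-- s(σ̂ a₁,…,σ̂ aₙ) with aᵢ ∈ Lᵢ, each of which lies below σ♭(s(L₁,…,Lₙ)).
module Submission where

open import Defs
open import Data.Empty using (⊥-elim)
open import Data.Fin using (Fin; zero; suc)
import Data.Fin as F
open import Data.Fin.Properties using (suc-injective)
open import Data.Nat using (ℕ; zero; suc)
open import Data.Product using (_×_; _,_; proj₁; proj₂)
open import Data.Vec.Functional using (_∷_; tail)
open import Relation.Nullary using (yes; no)
open import Relation.Binary.PropositionalEquality
  using (_≡_; refl; sym; cong)

[≔]-self : {A : Set} {n : ℕ} (xs : Fin n → A) (i j : Fin n) → (xs [ i ≔ xs i ]) j ≡ xs j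
[≔]-self xs i j with i F.≟ j
... | yes refl = refl
... | no _     = refl

[zero≔]-∷ : {A : Set} {n : ℕ} (xs : Fin (suc n) → A) (x : A) (j : Fin (suc n)) →
            (xs [ zero ≔ x ]) j ≡ (x ∷ tail xs) j
[zero≔]-∷ xs x zero    = refl
[zero≔]-∷ xs x (suc j) = refl

∷-[suc≔] : {A : Set} {n : ℕ} (x : A) (ys : Fin n → A) (i : Fin n) (y : A) (j : Fin (suc n)) →
           ((x ∷ ys) [ suc i ≔ y ]) j ≡ (x ∷ (ys [ i ≔ y ])) j
∷-[suc≔] x ys i y zero = refl
∷-[suc≔] x ys i y (suc j) with suc i F.≟ suc j | i F.≟ j
... | yes _  | yes _  = refl
... | no _   | no _   = refl
... | yes si≡sj | no i≢j  = ⊥-elim (i≢j (suc-injective si≡sj))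
... | no si≢sj  | yes i≡j = ⊥-elim (si≢sj (cong suc i≡j))

module _ {Sig : Signature} (M : ContinuousAlgebra Sig) where
  open Signature Sig
  open ContinuousAlgebra M renaming (refl to ≤-refl)
  open import Relation.Binary.Reasoning.PartialOrder poset

  ⋁-mono : {I : Set} {f h : I → C} → (∀ i → f i ≤ h i) → ⋁ f ≤ ⋁ h
  ⋁-mono {h = h} f≤h = ⋁-least _ (⋁ h) (λ i → trans (f≤h i) (⋁-upper h i))

  record SeparatelyContinuous {n : ℕ} (g : (Fin n → C) → C) : Set₁ where
    field
      monotoneⁿ   : ∀ {xs ys} → (∀ i → xs i ≤ ys i) → g xs ≤ g ys
      continuousⁿ : ∀ xs i {I : Set} (f : I → C) →
                    g (xs [ i ≔ ⋁ f ]) ≤ ⋁ (λ j → g (xs [ i ≔ f j ]))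

    monotone-≗ : ∀ {xs ys} → (∀ i → xs i ≡ ys i) → g xs ≤ g ys
    monotone-≗ xs≗ys = monotoneⁿ (λ i → reflexive (Eq.reflexive (xs≗ys i)))

  open SeparatelyContinuous

  ⟦⟧-separatelyContinuous : (o : Op) → SeparatelyContinuous ⟦ o ⟧
  ⟦⟧-separatelyContinuous o = record
    { monotoneⁿ   = monotone o _ _
    ; continuousⁿ = λ xs i f → reflexive (continuous o xs i f)
    }

  ∷-separatelyContinuous : {n : ℕ} {g : (Fin (suc n) → C) → C} → SeparatelyContinuous g →
                           (x : C) → SeparatelyContinuous (λ ys → g (x ∷ ys))
  ∷-separatelyContinuous {g = g} cg x = record
    { monotoneⁿ   = λ xs≤ys → monotoneⁿ cg (λ { zero → ≤-refl ; (suc i) → xs≤ys i })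
    ; continuousⁿ = λ ys i f → begin
        g (x ∷ (ys [ i ≔ ⋁ f ]))
          ≤⟨ monotone-≗ cg (λ j → sym (∷-[suc≔] x ys i _ j)) ⟩
        g ((x ∷ ys) [ suc i ≔ ⋁ f ])
          ≤⟨ continuousⁿ cg (x ∷ ys) (suc i) f ⟩
        ⋁ (λ j → g ((x ∷ ys) [ suc i ≔ f j ]))
          ≤⟨ ⋁-mono (λ j → monotone-≗ cg (∷-[suc≔] x ys i (f j))) ⟩
        ⋁ (λ j → g (x ∷ (ys [ i ≔ f j ])))
          ∎
    }

  separately⇒jointly-continuous :
    {n : ℕ} {g : (Fin n → C) → C} → SeparatelyContinuous g →
    {I : Fin n → Set} (fs : (i : Fin n) → I i → C) →
    g (λ i → ⋁ (fs i)) ≤ ⋁ {(i : Fin n) → I i} (λ js → g (λ i → fs i (js i)))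
  separately⇒jointly-continuous {zero} cg fs = trans (monotoneⁿ cg (λ ())) (⋁-upper _ (λ ()))
  separately⇒jointly-continuous {suc n} {g} cg fs = begin
    g xs                                     ≤⟨ monotone-≗ cg (λ j → sym ([≔]-self xs zero j)) ⟩
    g (xs [ zero ≔ ⋁ (fs zero) ])           ≤⟨ continuousⁿ cg xs zero (fs zero) ⟩
    ⋁ (λ j₀ → g (xs [ zero ≔ fs zero j₀ ])) ≤⟨ ⋁-least _ _ fixing-first ⟩
    ⋁ (λ js → g (λ i → fs i (js i)))        ∎
    where
      xs : Fin (suc n) → C
      xs i = ⋁ (fs i)
      fixing-first : ∀ j₀ → g (xs [ zero ≔ fs zero j₀ ]) ≤ ⋁ (λ js → g (λ i → fs i (js i)))
      fixing-first j₀ = begin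
        g (xs [ zero ≔ fs zero j₀ ])   ≤⟨ monotone-≗ cg ([zero≔]-∷ xs _) ⟩
        g (fs zero j₀ ∷ tail xs)       ≤⟨ separately⇒jointly-continuous
                                            (∷-separatelyContinuous cg (fs zero j₀)) (λ i → fs (suc i)) ⟩
        ⋁ (λ js → g (fs zero j₀ ∷ (λ i → fs (suc i) (js i))))
          ≤⟨ ⋁-least _ _ (λ js → trans (monotone-≗ cg (λ { zero → refl ; (suc i) → refl }))
                                       (⋁-upper _ (λ { zero → j₀ ; (suc i) → js i }))) ⟩
        ⋁ (λ js → g (λ i → fs i (js i)))  ∎

  ⟦⟧-cong : (o : Op) {xs ys : Fin (arity o) → C} → (∀ i → xs i ≈ ys i) → ⟦ o ⟧ xs ≈ ⟦ o ⟧ ys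
  ⟦⟧-cong o xs≈ys = antisym (monotone o _ _ (λ i → reflexive (xs≈ys i)))
                            (monotone o _ _ (λ i → reflexive (Eq.sym (xs≈ys i))))

  eval-subst : {X Y : Set} (τ : X → C) (θ : Y → Term Sig X) (t : Term Sig Y) →
               eval M τ (subst Sig θ t) ≈ eval M (λ y → eval M τ (θ y)) t
  eval-subst τ θ (var y)   = Eq.refl
  eval-subst τ θ (op o ts) = ⟦⟧-cong o (λ i → eval-subst τ θ (ts i))

  eval-⊢≈ : {E : Equation Sig → Set} → Satisfies M E → {X : Set} (σ : X → C) {a b : Term Sig X} →
            _⊢_≈_ Sig E a b → eval M σ a ≈ eval M σ b
  eval-⊢≈ sat σ ≈-refl          = Eq.refl
  eval-⊢≈ sat σ (≈-sym p)       = Eq.sym (eval-⊢≈ sat σ p)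
  eval-⊢≈ sat σ (≈-trans p q)   = Eq.trans (eval-⊢≈ sat σ p) (eval-⊢≈ sat σ q)
  eval-⊢≈ sat σ (≈-cong o ps)   = ⟦⟧-cong o (λ i → eval-⊢≈ sat σ (ps i))
  eval-⊢≈ sat σ (≈-ax {e} e∈E θ) = begin-equality
    eval M σ (subst Sig θ (Equation.lhs e))        ≈⟨ eval-subst σ θ (Equation.lhs e) ⟩
    eval M (λ y → eval M σ (θ y)) (Equation.lhs e) ≈⟨ sat e e∈E (λ y → eval M σ (θ y)) ⟩
    eval M (λ y → eval M σ (θ y)) (Equation.rhs e) ≈⟨ Eq.sym (eval-subst σ θ (Equation.rhs e)) ⟩
    eval M σ (subst Sig θ (Equation.rhs e))        ∎

  flat-⋃ : {E : Equation Sig → Set} {X : Set} (σ : X → C) {I : Set} (Ls : I → AtomSet Sig E X) →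
           flat M σ (⋃ Sig Ls) ≈ ⋁ (λ i → flat M σ (Ls i))
  flat-⋃ σ Ls = antisym
    (⋁-least _ _ (λ { (a , i , a∈Lᵢ) → trans (⋁-upper _ (a , a∈Lᵢ)) (⋁-upper _ i) }))
    (⋁-least _ _ (λ i → ⋁-least _ _ (λ { (a , a∈Lᵢ) → ⋁-upper _ (a , i , a∈Lᵢ) })))

  flat-opL : {E : Equation Sig → Set} → Satisfies M E → {X : Set} (σ : X → C)
             (o : Op) (Ls : Fin (arity o) → AtomSet Sig E X) →
             flat M σ (opL Sig o Ls) ≈ ⟦ o ⟧ (λ i → flat M σ (Ls i))
  flat-opL sat σ o Ls = antisym
    (⋁-least _ _ (λ { (a , as , as∈Ls , op-as≈a) → begin
      eval M σ a                       ≈⟨ Eq.sym (eval-⊢≈ sat σ op-as≈a) ⟩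
      ⟦ o ⟧ (λ i → eval M σ (as i))    ≤⟨ monotone o _ _ (λ i → ⋁-upper _ (as i , as∈Ls i)) ⟩
      ⟦ o ⟧ (λ i → flat M σ (Ls i))    ∎ }))
    (begin
      ⟦ o ⟧ (λ i → flat M σ (Ls i))
        ≤⟨ separately⇒jointly-continuous (⟦⟧-separatelyContinuous o) _ ⟩
      ⋁ (λ as → ⟦ o ⟧ (λ i → eval M σ (proj₁ (as i))))
        ≤⟨ ⋁-least _ _ (λ as → ⋁-upper _ (op o (λ i → proj₁ (as i)) ,
                                          (λ i → proj₁ (as i)) , (λ i → proj₂ (as i)) , ≈-refl)) ⟩
      flat M σ (opL Sig o Ls)          ∎)

-- Linearity and regularity of E are what make 𝓛(X)_E itself a continuous model of E;
-- the homomorphism property of σ♭ only needs M ⊨ E.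
proposition3p14 : (Sig : Signature) (E : Equation Sig → Set) →
    (∀ e → E e → Linear Sig e × Regular Sig e) →
    (X : Set) (M : ContinuousAlgebra Sig) → Satisfies M E →
    (σ : X → ContinuousAlgebra.C M) →
    ((o : Signature.Op Sig) (Ls : Fin (Signature.arity Sig o) → AtomSet Sig E X) →
      ContinuousAlgebra._≈_ M (flat M σ (opL Sig o Ls))
        (ContinuousAlgebra.⟦_⟧ M o (λ i → flat M σ (Ls i))))
    × ((I : Set) (Ls : I → AtomSet Sig E X) →
      ContinuousAlgebra._≈_ M (flat M σ (⋃ Sig Ls))
        (ContinuousAlgebra.⋁ M (λ i → flat M σ (Ls i))))
proposition3p14 Sig E _ X M sat σ = flat-opL M sat σ , λ I → flat-⋃ M σ
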